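{- For any $n,\ell\in\mathbb{N}$ (with $\ell\ge 2$), \[\binom{n}{2}-(n-1)\le\max(n,\ell)\le\binom{n}{2}-\left\lfloor\frac{n}{2}\right\rfloor.\]
   Context: All graphs are finite and simple; labels lie in $\mathbb{Z}_\ell$. In the neighborhood Lights Out game on a graph $G$, each vertex carries a label in $\mathbb{Z}_\ell$; toggling a vertex $v$ adds $1$ (mod $\ell$) to the label of every vertex of the closed neighborhood $N[v]$; the game is won when all labels are $0$. $G$ is $N$-AW if the game can be won from every initial labeling. $\max(n,\ell)$ is the maximum number of edges of an $N$-AW graph on $n$ vertices. -}

module Defs where

open import Data.Nat using (ℕ; zero; suc; _+_; _∸_; _≡ᵇ_; _<ᵇ_; _≤_; _/_)
open import Data.Nat.Combinatorics using (_C_)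
open import Data.Bool using (Bool; true; false; if_then_else_; _∨_; _∧_)
open import Data.Fin using (Fin; toℕ)
open import Data.Fin.Properties using (_≟_)
open import Data.List using (List; []; _∷_; map; allFin)
open import Data.Nat.ListAction using (sum)
open import Data.Product using (Σ; _×_)
open import Relation.Nullary.Decidable using (⌊_⌋)
open import Relation.Binary.PropositionalEquality using (_≡_)

record Graph (n : ℕ) : Set where
  field
    adj   : Fin n → Fin n → Bool
    sym   : ∀ u v → adj u v ≡ adj v u
    irref : ∀ v → adj v v ≡ false
open Graph public

edgeCount : ∀ {n} → Graph n → ℕ
edgeCount {n} G =
  sum (map (λ i → sum (map (λ j → if (toℕ i <ᵇ toℕ j) ∧ adj G i j then 1 else 0)
                           (allFin n)))
           (allFin n))

inN : ∀ {n} → Graph n → Fin n → Fin n → Bool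
inN G v u = ⌊ u ≟ v ⌋ ∨ adj G v u

-- Labels: elements of ℤ_ℓ represented as naturals in [0, ℓ).
Labeling : ℕ → Set
Labeling n = Fin n → ℕ

-- x ↦ x + 1 (mod ℓ), for x < ℓ.
inc : ℕ → ℕ → ℕ
inc ℓ x = if suc x ≡ᵇ ℓ then 0 else suc x

toggle : ∀ {n} → ℕ → Graph n → Fin n → Labeling n → Labeling n
toggle ℓ G v s u = if inN G v u then inc ℓ (s u) else s u

play : ∀ {n} → ℕ → Graph n → List (Fin n) → Labeling n → Labeling n
play ℓ G []       s = s
play ℓ G (v ∷ vs) s = play ℓ G vs (toggle ℓ G v s)

Winnable : ∀ {n} (ℓ : ℕ) → Graph n → (Fin n → Fin ℓ) → Set
Winnable ℓ G c = Σ (List _) λ moves → ∀ u → play ℓ G moves (λ v → toℕ (c v)) u ≡ 0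

N-AW : ∀ {n} → ℕ → Graph n → Set
N-AW ℓ G = ∀ c → Winnable ℓ G c

module Submission where

-- Upper bound: if two vertices u ≠ v are adjacent to everything, every move adds
-- the same amount to both labels, so the labeling with 1 at u and 0 elsewhere
-- cannot be cleared.  Hence at most one vertex has no non-neighbour, the
-- non-neighbour counts add up to at least n − 1, and there are at least
-- ⌈(n − 1)/2⌉ = ⌊n/2⌋ non-edges.
--
-- Lower bound: a sequence of moves adds (mod ℓ) an integer combination of closed
-- neighbourhoods, so a graph is N-AW once every unit vector is such a
-- combination.  For n = 2m + 1 take a hub adjacent to everything and m pairs of
-- non-adjacent mates, all other pairs adjacent: N[hub] − N[v] is the unit vector
-- of the mate of v.  For n = 2m + 2 add an apex adjacent exactly to the second
-- vertex of each pair; the unit vectors are obtained similarly.  In both cases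
-- the complement is a forest numbered so that every vertex has at most one
-- earlier non-neighbour, which bounds the non-edges by n − 1.

open import Defs hiding (sym)
open import Data.Bool using (Bool; true; false; not; _∧_; _∨_; if_then_else_; T)
open import Data.Bool.Properties using (not-injective; not-involutive)
open import Data.Empty using (⊥-elim)
open import Data.Fin using (Fin; zero; suc; toℕ)
open import Data.Fin.Properties using (_≟_; toℕ<n; toℕ-injective; suc-injective) renaming (0≢1+n to zero≢suc)
open import Data.List using (List; []; _∷_; _++_; map; allFin; tabulate; length)
open import Data.List.Properties using (map-tabulate)
import Data.Nat.ListAction as List
open import Data.Nat using (ℕ; zero; suc; _+_; _*_; _∸_; _≤_; _<_; _/_; _%_; _<ᵇ_; _≡ᵇ_; pred; z≤n; s≤s; NonZero)
open import Data.Nat.Combinatorics using (_C_; nC1≡n; nCk+nC[k+1]≡[n+1]C[k+1])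
open import Data.Nat.DivMod
  using (%-distribˡ-+; %-pred-≡0; [m+kn]%n≡m%n; m<n⇒m%n≡m; m%n%n≡m%n; m%n<n; n%n≡0; m<n*o⇒m/o<n)
open import Data.Nat.Properties hiding (_≟_; suc-injective)
open import Algebra.Properties.CommutativeMonoid.Sum +-0-commutativeMonoid
  using (sum; sum-syntax; ∑-distrib-+; ∑-comm; sum-cong-≗; sum-replicate-zero)
open import Data.Product using (Σ; _×_; _,_; proj₁; proj₂)
open import Function using (_∘_; id)
open import Relation.Nullary using (yes; no)
open import Relation.Nullary.Decidable using (⌊_⌋; isYes≗does; dec-true; dec-false; ⌊⌋-map′)
open import Relation.Binary.PropositionalEquality

𝟙 : Bool → ℕ
𝟙 b = if b then 1 else 0

𝟙≤1 : ∀ b → 𝟙 b ≤ 1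
𝟙≤1 true  = s≤s z≤n
𝟙≤1 false = z≤n

𝟙-not+𝟙 : ∀ b → 𝟙 (not b) + 𝟙 b ≡ 1
𝟙-not+𝟙 true  = refl
𝟙-not+𝟙 false = refl

𝟙-∧-split : ∀ b c → 𝟙 (b ∧ c) + 𝟙 (b ∧ not c) ≡ 𝟙 b
𝟙-∧-split false c     = refl
𝟙-∧-split true  true  = refl
𝟙-∧-split true  false = refl

≟-refl : ∀ {n} (x : Fin n) → ⌊ x ≟ x ⌋ ≡ true
≟-refl x = trans (isYes≗does (x ≟ x)) (dec-true (x ≟ x) refl)

≟-≢ : ∀ {n} {x y : Fin n} → x ≢ y → ⌊ x ≟ y ⌋ ≡ false
≟-≢ {x = x} {y} x≢y = trans (isYes≗does (x ≟ y)) (dec-false (x ≟ y) x≢y)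

≟-true : ∀ {n} {x y : Fin n} → ⌊ x ≟ y ⌋ ≡ true → x ≡ y
≟-true {x = x} {y} eq with x ≟ y
... | yes x≡y = x≡y

≟-sym : ∀ {n} (x y : Fin n) → ⌊ x ≟ y ⌋ ≡ ⌊ y ≟ x ⌋
≟-sym x y with y ≟ x
... | yes refl = ≟-refl x
... | no y≢x   = ≟-≢ (y≢x ∘ sym)

≟-suc : ∀ {n} (x y : Fin n) → ⌊ suc x ≟ suc y ⌋ ≡ ⌊ x ≟ y ⌋
≟-suc x y = ⌊⌋-map′ (cong suc) suc-injective (x ≟ y)

δ : ∀ {n} → Fin n → Fin n → ℕ
δ v x = 𝟙 ⌊ x ≟ v ⌋

δ-≢ : ∀ {n} {v x : Fin n} → x ≢ v → δ v x ≡ 0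
δ-≢ x≢v = cong 𝟙 (≟-≢ x≢v)

∑-mono-≤ : ∀ {n} {f g : Fin n → ℕ} → (∀ i → f i ≤ g i) → sum f ≤ sum g
∑-mono-≤ {zero}  f≤g = z≤n
∑-mono-≤ {suc n} f≤g = +-mono-≤ (f≤g zero) (∑-mono-≤ (f≤g ∘ suc))

term-≤-∑ : ∀ {n} (f : Fin n → ℕ) i → f i ≤ sum f
term-≤-∑ f zero    = m≤m+n _ _
term-≤-∑ f (suc i) = ≤-trans (term-≤-∑ (f ∘ suc) i) (m≤n+m _ _)

∑-ones : ∀ n → sum {n} (λ _ → 1) ≡ n
∑-ones zero    = refl
∑-ones (suc n) = cong suc (∑-ones n)

∑-≤-size : ∀ {n} {f : Fin n → ℕ} → (∀ i → f i ≤ 1) → sum f ≤ n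
∑-≤-size {n} f≤1 = ≤-trans (∑-mono-≤ f≤1) (≤-reflexive (∑-ones n))

size-≤-∑ : ∀ {n} {f : Fin n → ℕ} → (∀ i → f i ≢ 0) → n ≤ sum f
size-≤-∑ {n} f≢0 = ≤-trans (≤-reflexive (sym (∑-ones n))) (∑-mono-≤ (n≢0⇒n>0 ∘ f≢0))

size-≤-suc-∑ : ∀ {n} (f : Fin n → ℕ) → (∀ i j → f i ≡ 0 → f j ≡ 0 → i ≡ j) → n ≤ suc (sum f)
size-≤-suc-∑ {zero}  f unique = z≤n
size-≤-suc-∑ {suc n} f unique with f zero in f₀
... | zero  = s≤s (size-≤-∑ λ i fᵢ≡0 → zero≢suc (unique zero (suc i) f₀ fᵢ≡0))
... | suc a = s≤s (≤-trans (size-≤-suc-∑ (f ∘ suc) λ i j p q → suc-injective (unique (suc i) (suc j) p q))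
                           (s≤s (m≤n+m _ a)))

∑-supported : ∀ {n} (f : Fin n → ℕ) t → (∀ i → i ≢ t → f i ≡ 0) → sum f ≡ f t
∑-supported {suc n} f zero vanish = begin
  f zero + sum (f ∘ suc)       ≡⟨ cong (f zero +_) (sum-cong-≗ (λ i → vanish (suc i) λ ())) ⟩
  f zero + sum {n} (λ _ → 0)   ≡⟨ cong (f zero +_) (sum-replicate-zero n) ⟩
  f zero + 0                   ≡⟨ +-identityʳ (f zero) ⟩
  f zero                       ∎
  where open ≡-Reasoning
∑-supported {suc n} f (suc t) vanish =
  cong₂ _+_ (vanish zero λ ()) (∑-supported (f ∘ suc) t λ i i≢t → vanish (suc i) (i≢t ∘ suc-injective))

∑-*-δ : ∀ {n} (f : Fin n → ℕ) x → sum (λ v → f v * δ v x) ≡ f x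
∑-*-δ f x = trans (∑-supported (λ v → f v * δ v x) x vanish)
                  (trans (cong (λ b → f x * 𝟙 b) (≟-refl x)) (*-identityʳ (f x)))
  where
  vanish : ∀ v → v ≢ x → f v * δ v x ≡ 0
  vanish v v≢x = trans (cong (f v *_) (δ-≢ (v≢x ∘ sym))) (*-zeroʳ (f v))

listSum-allFin : ∀ {n} (f : Fin n → ℕ) → List.sum (map f (allFin n)) ≡ sum f
listSum-allFin {n} f = trans (cong List.sum (map-tabulate id f)) (sumTabulate f)
  where
  sumTabulate : ∀ {n} (f : Fin n → ℕ) → List.sum (tabulate f) ≡ sum f
  sumTabulate {zero}  f = refl
  sumTabulate {suc n} f = cong (f zero +_) (sumTabulate (f ∘ suc))

half-≤ : ∀ {n m} → n ≤ suc (m + m) → n / 2 ≤ m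
half-≤ {n} {m} n≤ = <⇒≤pred (m<n*o⇒m/o<n (s≤s (≤-trans n≤ (≤-reflexive (cong suc 2m≡)))))
  where
  2m≡ : m + m ≡ m * 2
  2m≡ = trans (cong (m +_) (sym (+-identityʳ m))) (*-comm 2 m)

-- Edges and non-edges

nonEdge : ∀ {n} → Graph n → Fin n → Fin n → Bool
nonEdge G i j = (toℕ i <ᵇ toℕ j) ∧ not (adj G i j)

nonEdgeCount : ∀ {n} → Graph n → ℕ
nonEdgeCount {n} G = ∑[ i < n ] ∑[ j < n ] 𝟙 (nonEdge G i j)

∑∑-ordered-pairs : ∀ n → ∑[ i < n ] ∑[ j < n ] 𝟙 (toℕ i <ᵇ toℕ j) ≡ n C 2
∑∑-ordered-pairs zero    = refl
∑∑-ordered-pairs (suc n) = begin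
  sum {n} (λ _ → 1) + ∑[ i < n ] ∑[ j < n ] 𝟙 (toℕ i <ᵇ toℕ j)
    ≡⟨ cong₂ _+_ (∑-ones n) (∑∑-ordered-pairs n) ⟩
  n + n C 2      ≡⟨ cong (_+ n C 2) (sym (nC1≡n n)) ⟩
  n C 1 + n C 2  ≡⟨ nCk+nC[k+1]≡[n+1]C[k+1] n 1 ⟩
  suc n C 2      ∎
  where open ≡-Reasoning

edgeCount+nonEdgeCount : ∀ {n} (G : Graph n) → edgeCount G + nonEdgeCount G ≡ n C 2
edgeCount+nonEdgeCount {n} G = begin
  edgeCount G + nonEdgeCount G
    ≡⟨ cong (_+ nonEdgeCount G) (listSum-allFin row) ⟩
  ∑[ i < n ] row i + nonEdgeCount G
    ≡⟨ cong (_+ nonEdgeCount G) (sum-cong-≗ λ i → listSum-allFin (entry i)) ⟩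
  ∑[ i < n ] ∑[ j < n ] entry i j + ∑[ i < n ] ∑[ j < n ] 𝟙 (nonEdge G i j)
    ≡⟨ ∑-distrib-+ (λ i → ∑[ j < n ] entry i j) (λ i → ∑[ j < n ] 𝟙 (nonEdge G i j)) ⟨
  ∑[ i < n ] (∑[ j < n ] entry i j + ∑[ j < n ] 𝟙 (nonEdge G i j))
    ≡⟨ sum-cong-≗ (λ i → trans (sym (∑-distrib-+ (entry i) (𝟙 ∘ nonEdge G i)))
                                (sum-cong-≗ λ j → 𝟙-∧-split (toℕ i <ᵇ toℕ j) (adj G i j))) ⟩
  ∑[ i < n ] ∑[ j < n ] 𝟙 (toℕ i <ᵇ toℕ j)
    ≡⟨ ∑∑-ordered-pairs n ⟩
  n C 2 ∎
  where
  open ≡-Reasoning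
  entry : Fin n → Fin n → ℕ
  entry i j = 𝟙 ((toℕ i <ᵇ toℕ j) ∧ adj G i j)
  row : Fin n → ℕ
  row i = List.sum (map (entry i) (allFin n))

edgeCount≡ : ∀ {n} (G : Graph n) → edgeCount G ≡ n C 2 ∸ nonEdgeCount G
edgeCount≡ G = trans (sym (m+n∸n≡m (edgeCount G) (nonEdgeCount G)))
                     (cong (_∸ nonEdgeCount G) (edgeCount+nonEdgeCount G))

coDegree : ∀ {n} → Graph n → Fin n → ℕ
coDegree {n} G i = ∑[ j < n ] (𝟙 (nonEdge G i j) + 𝟙 (nonEdge G j i))

∑-coDegree : ∀ {n} (G : Graph n) → ∑[ i < n ] coDegree G i ≡ nonEdgeCount G + nonEdgeCount G
∑-coDegree {n} G = begin
  ∑[ i < n ] coDegree G i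
    ≡⟨ sum-cong-≗ (λ i → ∑-distrib-+ (𝟙 ∘ nonEdge G i) (λ j → 𝟙 (nonEdge G j i))) ⟩
  ∑[ i < n ] (∑[ j < n ] 𝟙 (nonEdge G i j) + ∑[ j < n ] 𝟙 (nonEdge G j i))
    ≡⟨ ∑-distrib-+ (λ i → ∑[ j < n ] 𝟙 (nonEdge G i j)) (λ i → ∑[ j < n ] 𝟙 (nonEdge G j i)) ⟩
  nonEdgeCount G + ∑[ i < n ] ∑[ j < n ] 𝟙 (nonEdge G j i)
    ≡⟨ cong (nonEdgeCount G +_) (∑-comm (λ i j → 𝟙 (nonEdge G j i))) ⟩
  nonEdgeCount G + nonEdgeCount G ∎
  where open ≡-Reasoning

nonAdjacent⇒nonEdge : ∀ {n} (G : Graph n) {i j} → i ≢ j → adj G i j ≡ false →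
                      1 ≤ 𝟙 (nonEdge G i j) + 𝟙 (nonEdge G j i)
nonAdjacent⇒nonEdge G {i} {j} i≢j ¬adj with toℕ i <ᵇ toℕ j in i<j | toℕ j <ᵇ toℕ i in j<i
... | true  | _    rewrite ¬adj = s≤s z≤n
... | false | true rewrite Graph.sym G j i | ¬adj = s≤s z≤n
... | false | false = ⊥-elim (i≢j (toℕ-injective (≤-antisym (not< j<i) (not< i<j))))
  where
  not< : ∀ {a b} → (b <ᵇ a) ≡ false → a ≤ b
  not< b≮a = ≮⇒≥ λ b<a → subst T b≮a (<⇒<ᵇ b<a)

Universal : ∀ {n} → Graph n → Fin n → Set
Universal G u = ∀ w → inN G w u ≡ true

coDegree≡0⇒universal : ∀ {n} (G : Graph n) {u} → coDegree G u ≡ 0 → Universal G u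
coDegree≡0⇒universal G {u} coDeg≡0 w with u ≟ w
... | yes _  = refl
... | no u≢w with adj G w u in e
...   | true  = refl
...   | false = ⊥-elim (1+n≰n (≤-trans (nonAdjacent⇒nonEdge G u≢w (trans (Graph.sym G u w) e))
                          (≤-trans (term-≤-∑ (λ j → 𝟙 (nonEdge G u j) + 𝟙 (nonEdge G j u)) w)
                                   (≤-reflexive coDeg≡0))))

n/2≤nonEdgeCount : ∀ {n} (G : Graph n) → (∀ u v → Universal G u → Universal G v → u ≡ v) →
                   n / 2 ≤ nonEdgeCount G
n/2≤nonEdgeCount {n} G unique = half-≤ (begin
  n                            ≤⟨ size-≤-suc-∑ (coDegree G) (λ u v p q →
                                    unique u v (coDegree≡0⇒universal G p) (coDegree≡0⇒universal G q)) ⟩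
  suc (∑[ i < n ] coDegree G i) ≡⟨ cong suc (∑-coDegree G) ⟩
  suc (nonEdgeCount G + nonEdgeCount G) ∎)
  where open ≤-Reasoning

nonEdgeCount≤n∸1 : ∀ {n} (G : Graph n) (earlier : Fin n → Fin n) →
                   (∀ i j → toℕ i < toℕ j → adj G i j ≡ false → i ≡ earlier j) →
                   nonEdgeCount G ≤ n ∸ 1
nonEdgeCount≤n∸1 {zero}  G earlier unique = z≤n
nonEdgeCount≤n∸1 {suc n} G earlier unique = begin
  nonEdgeCount G                          ≡⟨ ∑-comm (λ i j → 𝟙 (nonEdge G i j)) ⟩
  sum {suc n} (λ _ → 0) + later-columns   ≡⟨ cong (_+ later-columns) (sum-replicate-zero (suc n)) ⟩
  later-columns                           ≤⟨ ∑-≤-size (λ j → column≤1 (suc j)) ⟩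
  n                                       ∎
  where
  open ≤-Reasoning
  column : Fin (suc n) → ℕ
  column j = ∑[ i < suc n ] 𝟙 (nonEdge G i j)
  later-columns : ℕ
  later-columns = ∑[ j < n ] column (suc j)
  column≤1 : ∀ j → column j ≤ 1
  column≤1 j = ≤-trans (≤-reflexive (∑-supported (λ i → 𝟙 (nonEdge G i j)) (earlier j) vanish)) (𝟙≤1 _)
    where
    vanish : ∀ i → i ≢ earlier j → 𝟙 (nonEdge G i j) ≡ 0
    vanish i i≢ with toℕ i <ᵇ toℕ j in i<j | adj G i j in e
    ... | false | _     = refl
    ... | true  | true  = refl
    ... | true  | false = ⊥-elim (i≢ (unique i j (<ᵇ⇒< _ _ (subst T (sym i<j) _)) e))

-- Playing the game modulo ℓ

inc≡suc% : ∀ ℓ .{{_ : NonZero ℓ}} {x} → x < ℓ → inc ℓ x ≡ suc x % ℓ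
inc≡suc% ℓ {x} x<ℓ with suc x ≡ᵇ ℓ in eq
... | true  = trans (sym (n%n≡0 ℓ)) (cong (_% ℓ) (sym (≡ᵇ⇒≡ (suc x) ℓ (subst T (sym eq) _))))
... | false = sym (m<n⇒m%n≡m (≤∧≢⇒< x<ℓ λ 1+x≡ℓ → subst T eq (≡⇒≡ᵇ (suc x) ℓ 1+x≡ℓ)))

+-%-cong : ∀ ℓ .{{_ : NonZero ℓ}} {a a′ b b′} → a % ℓ ≡ a′ % ℓ → b % ℓ ≡ b′ % ℓ →
           (a + b) % ℓ ≡ (a′ + b′) % ℓ
+-%-cong ℓ {a} {a′} {b} {b′} a≡a′ b≡b′ = begin
  (a + b) % ℓ             ≡⟨ %-distribˡ-+ a b ℓ ⟩
  (a % ℓ + b % ℓ) % ℓ     ≡⟨ cong₂ (λ x y → (x + y) % ℓ) a≡a′ b≡b′ ⟩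
  (a′ % ℓ + b′ % ℓ) % ℓ   ≡⟨ %-distribˡ-+ a′ b′ ℓ ⟨
  (a′ + b′) % ℓ           ∎
  where open ≡-Reasoning

module Toggling {n : ℕ} (ℓ : ℕ) .{{_ : NonZero ℓ}} (G : Graph n) where

  hits : List (Fin n) → Fin n → ℕ
  hits []       x = 0
  hits (v ∷ vs) x = 𝟙 (inN G v x) + hits vs x

  hits-++ : ∀ vs ws x → hits (vs ++ ws) x ≡ hits vs x + hits ws x
  hits-++ []       ws x = refl
  hits-++ (v ∷ vs) ws x = trans (cong (𝟙 (inN G v x) +_) (hits-++ vs ws x))
                                (sym (+-assoc (𝟙 (inN G v x)) (hits vs x) (hits ws x)))

  hits-universal : ∀ {u} → Universal G u → ∀ vs → hits vs u ≡ length vs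
  hits-universal univ []       = refl
  hits-universal univ (v ∷ vs) rewrite univ v = cong suc (hits-universal univ vs)

  play≡hits : ∀ vs (s : Labeling n) → (∀ x → s x < ℓ) → ∀ x → play ℓ G vs s x ≡ (s x + hits vs x) % ℓ
  play≡hits []       s s<ℓ x = trans (sym (m<n⇒m%n≡m (s<ℓ x))) (cong (_% ℓ) (sym (+-identityʳ (s x))))
  play≡hits (v ∷ vs) s s<ℓ x = trans (play≡hits vs (toggle ℓ G v s) toggle<ℓ x) (step x)
    where
    toggle<ℓ : ∀ y → toggle ℓ G v s y < ℓ
    toggle<ℓ y with inN G v y
    ... | true  = subst (_< ℓ) (sym (inc≡suc% ℓ (s<ℓ y))) (m%n<n (suc (s y)) ℓ)
    ... | false = s<ℓ y
    step : ∀ y → (toggle ℓ G v s y + hits vs y) % ℓ ≡ (s y + hits (v ∷ vs) y) % ℓ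
    step y with inN G v y
    ... | false = refl
    ... | true  = begin
      (inc ℓ (s y) + hits vs y) % ℓ  ≡⟨ +-%-cong ℓ inc≡ refl ⟩
      (suc (s y) + hits vs y) % ℓ    ≡⟨ cong (_% ℓ) (+-suc (s y) (hits vs y)) ⟨
      (s y + suc (hits vs y)) % ℓ    ∎
      where
      open ≡-Reasoning
      inc≡ : inc ℓ (s y) % ℓ ≡ suc (s y) % ℓ
      inc≡ = trans (cong (_% ℓ) (inc≡suc% ℓ (s<ℓ y))) (m%n%n≡m%n (suc (s y)) ℓ)

  Achievable : (Fin n → ℕ) → Set
  Achievable d = Σ (List (Fin n)) λ vs → ∀ x → hits vs x % ℓ ≡ d x % ℓ

  achievable-resp : ∀ {d e} → (∀ x → d x % ℓ ≡ e x % ℓ) → Achievable d → Achievable e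
  achievable-resp d≡e (vs , hit) = vs , λ x → trans (hit x) (d≡e x)

  achievable-≗ : ∀ {d e} → (∀ x → d x ≡ e x) → Achievable d → Achievable e
  achievable-≗ d≡e = achievable-resp (cong (_% ℓ) ∘ d≡e)

  achievable-zero : Achievable (λ _ → 0)
  achievable-zero = [] , λ _ → refl

  achievable-nbhd : ∀ v → Achievable (𝟙 ∘ inN G v)
  achievable-nbhd v = v ∷ [] , λ x → cong (_% ℓ) (+-identityʳ _)

  achievable-+ : ∀ {d e} → Achievable d → Achievable e → Achievable (λ x → d x + e x)
  achievable-+ (vs , d) (ws , e) =
    vs ++ ws , λ x → trans (cong (_% ℓ) (hits-++ vs ws x)) (+-%-cong ℓ (d x) (e x))

  achievable-* : ∀ {d} k → Achievable d → Achievable (λ x → k * d x)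
  achievable-* zero    _ = achievable-zero
  achievable-* (suc k) d = achievable-+ d (achievable-* k d)

  achievable-∑ : ∀ {m} {F : Fin m → Fin n → ℕ} → (∀ w → Achievable (F w)) →
                 Achievable (λ x → ∑[ w < m ] F w x)
  achievable-∑ {zero}  _ = achievable-zero
  achievable-∑ {suc m} F = achievable-+ (F zero) (achievable-∑ (F ∘ suc))

  -- Subtracting d means adding it ℓ - 1 more times.
  achievable-cancelˡ : ∀ {d e} → Achievable (λ x → d x + e x) → Achievable d → Achievable e
  achievable-cancelˡ {d} {e} d+e d′ =
    achievable-resp cancel (achievable-+ d+e (achievable-* (pred ℓ) d′))
    where
    cancel : ∀ x → (d x + e x + pred ℓ * d x) % ℓ ≡ e x % ℓ
    cancel x = begin
      (d x + e x + pred ℓ * d x) % ℓ   ≡⟨ cong (λ t → (t + pred ℓ * d x) % ℓ) (+-comm (d x) (e x)) ⟩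
      (e x + d x + pred ℓ * d x) % ℓ   ≡⟨ cong (_% ℓ) (+-assoc (e x) (d x) (pred ℓ * d x)) ⟩
      (e x + suc (pred ℓ) * d x) % ℓ   ≡⟨ cong (λ t → (e x + t) % ℓ) (*-comm (suc (pred ℓ)) (d x)) ⟩
      (e x + d x * suc (pred ℓ)) % ℓ   ≡⟨ cong (λ t → (e x + d x * t) % ℓ) (suc-pred ℓ) ⟩
      (e x + d x * ℓ) % ℓ              ≡⟨ [m+kn]%n≡m%n (e x) (d x) ℓ ⟩
      e x % ℓ                          ∎
      where open ≡-Reasoning

  achievable-indicator : (p : Fin n → Bool) → (∀ w → p w ≡ true → Achievable (δ w)) → Achievable (𝟙 ∘ p)
  achievable-indicator p units = achievable-≗ (∑-*-δ (𝟙 ∘ p)) (achievable-∑ term)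
    where
    term : ∀ w → Achievable (λ x → 𝟙 (p w) * δ w x)
    term w with p w in pw
    ... | true  = achievable-≗ (λ x → sym (+-identityʳ (δ w x))) (units w pw)
    ... | false = achievable-zero

  achievable-nonNbhd : Achievable (λ _ → 1) → ∀ v → Achievable (λ x → 𝟙 (not (inN G v x)))
  achievable-nonNbhd ones v = achievable-cancelˡ (achievable-≗ complete ones) (achievable-nbhd v)
    where
    complete : ∀ x → 1 ≡ 𝟙 (inN G v x) + 𝟙 (not (inN G v x))
    complete x = trans (sym (𝟙-not+𝟙 (inN G v x))) (+-comm (𝟙 (not (inN G v x))) (𝟙 (inN G v x)))

  achievable-unit-by-nbhd : ∀ v → (∀ x → adj G v x ≡ true → Achievable (δ x)) → Achievable (δ v)
  achievable-unit-by-nbhd v units =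
    achievable-cancelˡ (achievable-≗ split (achievable-nbhd v)) (achievable-indicator (adj G v) units)
    where
    split : ∀ x → 𝟙 (inN G v x) ≡ 𝟙 (adj G v x) + δ v x
    split x with x ≟ v
    ... | yes refl rewrite irref G x = refl
    ... | no _     = sym (+-identityʳ _)

  N-AW-from-units : (∀ w → Achievable (δ w)) → N-AW ℓ G
  N-AW-from-units units c = moves , cleared
    where
    s : Labeling n
    s x = toℕ (c x)
    deficit : Fin n → ℕ
    deficit x = ℓ ∸ s x
    reach : Achievable deficit
    reach = achievable-≗ (∑-*-δ deficit) (achievable-∑ λ w → achievable-* (deficit w) (units w))
    moves : List (Fin n)
    moves = proj₁ reach
    cleared : ∀ u → play ℓ G moves s u ≡ 0
    cleared u = begin
      play ℓ G moves s u          ≡⟨ play≡hits moves s (toℕ<n ∘ c) u ⟩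
      (s u + hits moves u) % ℓ   ≡⟨ +-%-cong ℓ refl (proj₂ reach u) ⟩
      (s u + deficit u) % ℓ      ≡⟨ cong (_% ℓ) (m+[n∸m]≡n (<⇒≤ (toℕ<n (c u)))) ⟩
      ℓ % ℓ                      ≡⟨ n%n≡0 ℓ ⟩
      0                          ∎
      where open ≡-Reasoning

  N-AW-from-ones : Achievable (λ _ → 1) → ∀ z → (∀ w → w ≢ z → Achievable (δ w)) → N-AW ℓ G
  N-AW-from-ones ones z units = N-AW-from-units unit
    where
    others : Achievable (λ x → 𝟙 (not ⌊ x ≟ z ⌋))
    others = achievable-indicator (λ x → not ⌊ x ≟ z ⌋) unitOff
      where
      unitOff : ∀ w → not ⌊ w ≟ z ⌋ ≡ true → Achievable (δ w)
      unitOff w off with w ≟ z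
      ... | no w≢z = units w w≢z
    unit : ∀ w → Achievable (δ w)
    unit w with w ≟ z
    ... | yes refl = achievable-cancelˡ (achievable-≗ (λ x → sym (𝟙-not+𝟙 ⌊ x ≟ z ⌋)) ones) others
    ... | no w≢z   = units w w≢z

N-AW⇒universal-unique : ∀ {n k} (G : Graph n) → N-AW (suc (suc k)) G →
                        ∀ u v → Universal G u → Universal G v → u ≡ v
N-AW⇒universal-unique {n} {k} G aw u v univ-u univ-v with u ≟ v
... | yes u≡v = u≡v
... | no  u≢v = ⊥-elim (0≢1+n (begin
  0      ≡⟨ trans (cong (λ b → (𝟙 b + h) % ℓ) (sym (≟-≢ (u≢v ∘ sym)))) (cleared v univ-v) ⟨
  h % ℓ  ≡⟨ %-pred-≡0 {h} {ℓ} (trans (cong (λ b → (𝟙 b + h) % ℓ) (sym (≟-refl u))) (cleared u univ-u)) ⟩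
  suc k  ∎))
  where
  open ≡-Reasoning
  ℓ : ℕ
  ℓ = suc (suc k)
  open Toggling ℓ G
  c : Fin n → Fin ℓ
  c x = if ⌊ x ≟ u ⌋ then suc zero else zero
  c≡ : ∀ x → toℕ (c x) ≡ 𝟙 ⌊ x ≟ u ⌋
  c≡ x with ⌊ x ≟ u ⌋
  ... | true  = refl
  ... | false = refl
  moves : List (Fin n)
  moves = proj₁ (aw c)
  h : ℕ
  h = length moves
  cleared : ∀ x → Universal G x → (𝟙 ⌊ x ≟ u ⌋ + h) % ℓ ≡ 0
  cleared x univ = begin
    (𝟙 ⌊ x ≟ u ⌋ + h) % ℓ          ≡⟨ cong₂ (λ a t → (a + t) % ℓ) (c≡ x) (hits-universal univ moves) ⟨
    (toℕ (c x) + hits moves x) % ℓ  ≡⟨ play≡hits moves (toℕ ∘ c) (toℕ<n ∘ c) x ⟨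
    play ℓ G moves (toℕ ∘ c) x      ≡⟨ proj₂ (aw c) x ⟩
    0                               ∎

edgeCount-upperBound : ∀ {n k} (G : Graph n) → N-AW (suc (suc k)) G → edgeCount G ≤ n C 2 ∸ n / 2
edgeCount-upperBound {n} G aw = begin
  edgeCount G               ≡⟨ edgeCount≡ G ⟩
  n C 2 ∸ nonEdgeCount G    ≤⟨ ∸-monoʳ-≤ (n C 2) (n/2≤nonEdgeCount G (N-AW⇒universal-unique G aw)) ⟩
  n C 2 ∸ n / 2             ∎
  where open ≤-Reasoning

complementGraph : ∀ {n} (nonAdj : Fin n → Fin n → Bool) → (∀ u v → nonAdj u v ≡ nonAdj v u) → Graph n
complementGraph nonAdj nonAdj-sym = record
  { adj   = λ u v → not (⌊ u ≟ v ⌋ ∨ nonAdj u v)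
  ; sym   = λ u v → cong₂ (λ a b → not (a ∨ b)) (≟-sym u v) (nonAdj-sym u v)
  ; irref = λ v → cong (λ a → not (a ∨ nonAdj v v)) (≟-refl v)
  }

module _ {n} (nonAdj : Fin n → Fin n → Bool) (nonAdj-sym : ∀ u v → nonAdj u v ≡ nonAdj v u) where

  private
    G : Graph n
    G = complementGraph nonAdj nonAdj-sym

  inN-complementGraph : (∀ v → nonAdj v v ≡ false) → ∀ v x → inN G v x ≡ not (nonAdj v x)
  inN-complementGraph irrefl v x with x ≟ v
  ... | yes refl rewrite irrefl x = refl
  ... | no x≢v   rewrite ≟-≢ (x≢v ∘ sym) = refl

  nonEdgeCount-complementGraph≤n∸1 : (earlier : Fin n → Fin n) →
    (∀ i j → toℕ i < toℕ j → nonAdj i j ≡ true → i ≡ earlier j) → nonEdgeCount G ≤ n ∸ 1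
  nonEdgeCount-complementGraph≤n∸1 earlier unique =
    nonEdgeCount≤n∸1 G earlier λ i j i<j ¬adj → unique i j i<j (nonAdjacent i<j ¬adj)
    where
    nonAdjacent : ∀ {i j} → toℕ i < toℕ j → adj G i j ≡ false → nonAdj i j ≡ true
    nonAdjacent {i} {j} i<j ¬adj rewrite ≟-≢ (λ i≡j → <-irrefl (cong toℕ i≡j) i<j) = not-injective ¬adj

edgeCount-lowerBound : ∀ {n} (G : Graph n) → nonEdgeCount G ≤ n ∸ 1 → n C 2 ∸ (n ∸ 1) ≤ edgeCount G
edgeCount-lowerBound {n} G few = begin
  n C 2 ∸ (n ∸ 1)          ≤⟨ ∸-monoʳ-≤ (n C 2) few ⟩
  n C 2 ∸ nonEdgeCount G   ≡⟨ edgeCount≡ G ⟨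
  edgeCount G              ∎
  where open ≤-Reasoning

-- An odd count leaves its last vertex unpaired, as its own partner; only even counts are used.
partner : ∀ {n} → Fin n → Fin n
partner {suc zero}    zero          = zero
partner {suc (suc n)} zero          = suc zero
partner {suc (suc n)} (suc zero)    = zero
partner {suc (suc n)} (suc (suc x)) = suc (suc (partner x))

isFirst : ∀ {n} → Fin n → Bool
isFirst {suc zero}    zero          = false
isFirst {suc (suc n)} zero          = true
isFirst {suc (suc n)} (suc zero)    = false
isFirst {suc (suc n)} (suc (suc x)) = isFirst x

partner-involutive : ∀ {n} (x : Fin n) → partner (partner x) ≡ x
partner-involutive {suc zero}    zero          = refl
partner-involutive {suc (suc n)} zero          = refl
partner-involutive {suc (suc n)} (suc zero)    = refl
partner-involutive {suc (suc n)} (suc (suc x)) = cong (λ z → suc (suc z)) (partner-involutive x)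

partner-≢ : ∀ m (x : Fin (m * 2)) → partner x ≢ x
partner-≢ (suc m) zero          ()
partner-≢ (suc m) (suc zero)    ()
partner-≢ (suc m) (suc (suc x)) eq = partner-≢ m x (suc-injective (suc-injective eq))

isFirst-partner : ∀ m (x : Fin (m * 2)) → isFirst (partner x) ≡ not (isFirst x)
isFirst-partner (suc m) zero          = refl
isFirst-partner (suc m) (suc zero)    = refl
isFirst-partner (suc m) (suc (suc x)) = isFirst-partner m x

isFirst⇒partner-later : ∀ {n} (x : Fin n) → isFirst x ≡ true → toℕ x < toℕ (partner x)
isFirst⇒partner-later {suc zero}    zero          ()
isFirst⇒partner-later {suc (suc n)} zero          _     = s≤s z≤n
isFirst⇒partner-later {suc (suc n)} (suc zero)    ()
isFirst⇒partner-later {suc (suc n)} (suc (suc x)) first = s≤s (s≤s (isFirst⇒partner-later x first))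

mates-sym : ∀ {n} (x y : Fin n) → ⌊ y ≟ partner x ⌋ ≡ ⌊ x ≟ partner y ⌋
mates-sym x y with y ≟ partner x
... | yes refl rewrite partner-involutive x = sym (≟-refl x)
... | no  y≢x′ = sym (≟-≢ λ x≡y′ → y≢x′ (trans (sym (partner-involutive y)) (cong partner (sym x≡y′))))

-- Odd order: a hub and pairs of non-adjacent mates

oddNonAdj : ∀ {n} → Fin (suc n) → Fin (suc n) → Bool
oddNonAdj (suc x) (suc y) = ⌊ y ≟ partner x ⌋
oddNonAdj _       _       = false

oddNonAdj-sym : ∀ {n} (u v : Fin (suc n)) → oddNonAdj u v ≡ oddNonAdj v u
oddNonAdj-sym zero    zero    = refl
oddNonAdj-sym zero    (suc y) = refl
oddNonAdj-sym (suc x) zero    = refl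
oddNonAdj-sym (suc x) (suc y) = mates-sym x y

oddNonAdj-irrefl : ∀ m (v : Fin (suc (m * 2))) → oddNonAdj v v ≡ false
oddNonAdj-irrefl m zero    = refl
oddNonAdj-irrefl m (suc x) = ≟-≢ (partner-≢ m x ∘ sym)

oddNonAdj-sole : ∀ {n} (y : Fin n) x → oddNonAdj (suc (partner y)) x ≡ ⌊ x ≟ suc y ⌋
oddNonAdj-sole y zero    = refl
oddNonAdj-sole y (suc x) rewrite partner-involutive y = sym (≟-suc x y)

oddGraph : ∀ m → Graph (suc (m * 2))
oddGraph m = complementGraph oddNonAdj oddNonAdj-sym

oddMate : ∀ {n} → Fin (suc n) → Fin (suc n)
oddMate zero    = zero
oddMate (suc y) = suc (partner y)

oddNonAdj⇒oddMate : ∀ {n} {u v : Fin (suc n)} → oddNonAdj u v ≡ true → u ≡ oddMate v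
oddNonAdj⇒oddMate {u = suc x} {suc y} mates =
  cong suc (sym (trans (cong partner (≟-true mates)) (partner-involutive x)))

oddGraph-nonEdgeCount : ∀ m → nonEdgeCount (oddGraph m) ≤ suc (m * 2) ∸ 1
oddGraph-nonEdgeCount m =
  nonEdgeCount-complementGraph≤n∸1 oddNonAdj oddNonAdj-sym oddMate λ _ _ _ → oddNonAdj⇒oddMate

oddGraph-N-AW : ∀ m ℓ .{{_ : NonZero ℓ}} → N-AW ℓ (oddGraph m)
oddGraph-N-AW m ℓ = N-AW-from-ones ones zero unitOffHub
  where
  open Toggling ℓ (oddGraph m)
  inN≡ : ∀ v x → inN (oddGraph m) v x ≡ not (oddNonAdj v x)
  inN≡ = inN-complementGraph oddNonAdj oddNonAdj-sym (oddNonAdj-irrefl m)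
  ones : Achievable (λ _ → 1)
  ones = achievable-≗ (λ x → cong 𝟙 (inN≡ zero x)) (achievable-nbhd zero)
  unitOffHub : ∀ w → w ≢ zero → Achievable (δ w)
  unitOffHub zero    w≢0 = ⊥-elim (w≢0 refl)
  unitOffHub (suc y) _   = achievable-≗ sole (achievable-nonNbhd ones (suc (partner y)))
    where
    sole : ∀ x → 𝟙 (not (inN (oddGraph m) (suc (partner y)) x)) ≡ δ (suc y) x
    sole x = cong 𝟙 (trans (cong not (inN≡ (suc (partner y)) x))
                           (trans (not-involutive _) (oddNonAdj-sole y x)))

-- Even order: an apex adjacent to the second vertex of each pair

apexNonAdj : ∀ {n} → Fin (suc n) → Bool
apexNonAdj zero    = true
apexNonAdj (suc y) = isFirst y

evenNonAdj : ∀ {n} → Fin (suc (suc n)) → Fin (suc (suc n)) → Bool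
evenNonAdj zero    zero    = false
evenNonAdj zero    (suc v) = apexNonAdj v
evenNonAdj (suc u) zero    = apexNonAdj u
evenNonAdj (suc u) (suc v) = oddNonAdj u v

evenNonAdj-sym : ∀ {n} (u v : Fin (suc (suc n))) → evenNonAdj u v ≡ evenNonAdj v u
evenNonAdj-sym zero    zero    = refl
evenNonAdj-sym zero    (suc v) = refl
evenNonAdj-sym (suc u) zero    = refl
evenNonAdj-sym (suc u) (suc v) = oddNonAdj-sym u v

evenNonAdj-irrefl : ∀ m (v : Fin (suc (suc (m * 2)))) → evenNonAdj v v ≡ false
evenNonAdj-irrefl m zero    = refl
evenNonAdj-irrefl m (suc v) = oddNonAdj-irrefl m v

evenGraph : ∀ m → Graph (suc (suc (m * 2)))
evenGraph m = complementGraph evenNonAdj evenNonAdj-sym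

oddNonAdj-earlier⇒¬apex : ∀ {n} {u v : Fin (suc n)} → toℕ u < toℕ v → oddNonAdj u v ≡ true →
                          apexNonAdj v ≡ false
oddNonAdj-earlier⇒¬apex {u = suc x} {suc y} (s≤s x<y) mates with isFirst y in first
... | false = refl
... | true  = ⊥-elim (<-asym x<y (subst (λ z → toℕ y < toℕ z) y′≡x (isFirst⇒partner-later y first)))
  where
  y′≡x : partner y ≡ x
  y′≡x = trans (cong partner (≟-true mates)) (partner-involutive x)

evenMate : ∀ {n} → Fin (suc (suc n)) → Fin (suc (suc n))
evenMate zero    = zero
evenMate (suc v) = if apexNonAdj v then zero else suc (oddMate v)

evenNonAdj⇒evenMate : ∀ {n} (u v : Fin (suc (suc n))) → toℕ u < toℕ v → evenNonAdj u v ≡ true →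
                      u ≡ evenMate v
evenNonAdj⇒evenMate zero    (suc v) _         apex  rewrite apex = refl
evenNonAdj⇒evenMate (suc u) (suc v) (s≤s u<v) mates
  rewrite oddNonAdj-earlier⇒¬apex u<v mates = cong suc (oddNonAdj⇒oddMate mates)

evenGraph-nonEdgeCount : ∀ m → nonEdgeCount (evenGraph m) ≤ suc (suc (m * 2)) ∸ 1
evenGraph-nonEdgeCount m =
  nonEdgeCount-complementGraph≤n∸1 evenNonAdj evenNonAdj-sym evenMate evenNonAdj⇒evenMate

evenGraph-N-AW : ∀ m ℓ .{{_ : NonZero ℓ}} → N-AW ℓ (evenGraph m)
evenGraph-N-AW m ℓ = N-AW-from-ones ones hub unitOffHub
  where
  open Toggling ℓ (evenGraph m)
  G : Graph (suc (suc (m * 2)))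
  G = evenGraph m
  apex hub : Fin (suc (suc (m * 2)))
  apex = zero
  hub  = suc zero
  inN≡ : ∀ v x → inN G v x ≡ not (evenNonAdj v x)
  inN≡ = inN-complementGraph evenNonAdj evenNonAdj-sym (evenNonAdj-irrefl m)

  secondUnit : ∀ y → isFirst y ≡ false → Achievable (δ (suc (suc y)))
  secondUnit y second =
    achievable-cancelˡ (achievable-≗ split (achievable-nbhd hub)) (achievable-nbhd (suc (suc (partner y))))
    where
    split : ∀ x → 𝟙 (inN G hub x) ≡ 𝟙 (inN G (suc (suc (partner y))) x) + δ (suc (suc y)) x
    split x = trans (cong 𝟙 (inN≡ hub x))
                    (trans (split′ x) (cong (λ b → 𝟙 b + δ (suc (suc y)) x)
                                            (sym (inN≡ (suc (suc (partner y))) x))))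
      where
      split′ : ∀ x → 𝟙 (not (evenNonAdj hub x)) ≡
                     𝟙 (not (evenNonAdj (suc (suc (partner y))) x)) + δ (suc (suc y)) x
      split′ zero rewrite isFirst-partner m y | second = refl
      split′ (suc zero)    = refl
      split′ (suc (suc v)) rewrite partner-involutive y | ≟-suc (suc v) (suc y) | ≟-suc v y =
        sym (𝟙-not+𝟙 ⌊ v ≟ y ⌋)

  apexUnit : Achievable (δ apex)
  apexUnit = achievable-unit-by-nbhd apex nbrs
    where
    nbrs : ∀ x → adj G apex x ≡ true → Achievable (δ x)
    nbrs (suc (suc y)) second = secondUnit y (not-injective {isFirst y} {false} second)

  ones : Achievable (λ _ → 1)
  ones = achievable-≗ complete (achievable-+ (achievable-nbhd hub) apexUnit)
    where
    complete : ∀ x → 𝟙 (inN G hub x) + δ apex x ≡ 1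
    complete zero    = cong (λ b → 𝟙 b + 1) (inN≡ hub zero)
    complete (suc v) = cong (λ b → 𝟙 b + 0) (inN≡ hub (suc v))

  firstUnit : ∀ y → isFirst y ≡ true → Achievable (δ (suc (suc y)))
  firstUnit y first = achievable-≗ sole (achievable-nonNbhd ones (suc (suc (partner y))))
    where
    sole : ∀ x → 𝟙 (not (inN G (suc (suc (partner y))) x)) ≡ δ (suc (suc y)) x
    sole x = cong 𝟙 (trans (cong not (inN≡ (suc (suc (partner y))) x))
                           (trans (not-involutive _) (sole′ x)))
      where
      sole′ : ∀ x → evenNonAdj (suc (suc (partner y))) x ≡ ⌊ x ≟ suc (suc y) ⌋
      sole′ zero    rewrite isFirst-partner m y | first = refl
      sole′ (suc v) = trans (oddNonAdj-sole y v) (sym (≟-suc v (suc y)))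

  unitOffHub : ∀ w → w ≢ hub → Achievable (δ w)
  unitOffHub zero          _       = apexUnit
  unitOffHub (suc zero)    w≢hub   = ⊥-elim (w≢hub refl)
  unitOffHub (suc (suc y)) _ with isFirst y in first
  ... | true  = firstUnit y first
  ... | false = secondUnit y first

data Parity : ℕ → Set where
  even : ∀ m → Parity (m * 2)
  odd  : ∀ m → Parity (suc (m * 2))

parity : ∀ n → Parity n
parity zero = even zero
parity (suc n) with parity n
... | even m = odd m
... | odd  m = even (suc m)

dense-N-AW : ∀ ℓ .{{_ : NonZero ℓ}} {n} → Parity n →
             Σ (Graph n) λ G → N-AW ℓ G × n C 2 ∸ (n ∸ 1) ≤ edgeCount G
dense-N-AW ℓ (even zero)    = complementGraph (λ ()) (λ ()) , (λ c → [] , λ ()) , z≤n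
dense-N-AW ℓ (even (suc m)) =
  evenGraph m , evenGraph-N-AW m ℓ , edgeCount-lowerBound (evenGraph m) (evenGraph-nonEdgeCount m)
dense-N-AW ℓ (odd m)        =
  oddGraph m , oddGraph-N-AW m ℓ , edgeCount-lowerBound (oddGraph m) (oddGraph-nonEdgeCount m)

proposition4p1 : (n ℓ : ℕ) → 2 ≤ ℓ →
    (Σ (Graph n) λ G → N-AW ℓ G × (n C 2) ∸ (n ∸ 1) ≤ edgeCount G)
    × (∀ (G : Graph n) → N-AW ℓ G → edgeCount G ≤ (n C 2) ∸ (n / 2))
proposition4p1 n (suc (suc k)) (s≤s (s≤s _)) = dense-N-AW (suc (suc k)) (parity n) , edgeCount-upperBound
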